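{- Let $G$ be a graph with $\alpha(G) = 2$. Then $\chi_{\rho}(G) = \Delta(G) - \alpha(G) + 2$ if and only if $\Delta(G) = n(G)-1$ or $G\in \mathcal{H}$.
   Context: All graphs are finite and simple; $n(G)$ is the number of vertices, $\alpha(G)$ the independence number and $\Delta(G)$ the maximum degree of $G$. For a positive integer $i$, an $i$-packing in $G$ is a set $W\subseteq V(G)$ such that any two distinct vertices of $W$ are at distance greater than $i$ in $G$. The packing chromatic number $\chi_{\rho}(G)$ is the smallest integer $k$ such that $V(G)$ can be partitioned into sets $V_1,\dots,V_k$ with $V_i$ an $i$-packing for each $i\in\{1,\dots,k\}$. The class $\mathcal{H}$ consists of all graphs $H$ obtained as follows. Let $r\ge 3$ and $s\ge 2$ be integers. Let $A$ be a complete graph of order $r$ with three specified distinct vertices $a_1,a_2,a$, and let $B$ be a complete graph of order $s$ with two specified distinct vertices $b,b_1$. Take the disjoint union of $A$, $B$ and a new vertex $z$; add an edge between $z$ and every vertex of $B\setminus\{b\}$; then identify the vertices $a$ and $b$ into a single vertex $w$. The resulting graph has order $r+s$. Finally, any subset of the missing edges may be added, provided that no added edge is $a_1b_1$ and no added edge is incident to $z$ or to $a_2$. Every graph arising in this way belongs to $\mathcal{H}$. -}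

module Defs where

open import Data.Nat using (ℕ; zero; suc; _≤_; _⊔_)
open import Data.Bool using (Bool; true; false)
open import Data.Fin using (Fin; toℕ)
open import Data.Fin.Subset using (Subset; _∈_; ∣_∣)
open import Data.Vec using (tabulate)
open import Data.List using (foldr; map; allFin)
open import Data.Product using (Σ; ∃; _×_)
open import Relation.Nullary using (¬_)
open import Relation.Binary.PropositionalEquality using (_≡_; _≢_)

record Graph (n : ℕ) : Set where
  field
    adj     : Fin n → Fin n → Bool
    adj-sym : ∀ u v → adj u v ≡ adj v u
    irrefl  : ∀ v → adj v v ≡ false
open Graph public

Adj : ∀ {n} → Graph n → Fin n → Fin n → Set
Adj G u v = adj G u v ≡ true

data Walk {n : ℕ} (G : Graph n) : ℕ → Fin n → Fin n → Set where
  here : ∀ {u} → Walk G 0 u u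
  step : ∀ {k u v w} → Adj G u v → Walk G k v w → Walk G (suc k) u w

-- d(u,v) ≤ i  (distance infinite if disconnected)
DistLe : ∀ {n} → Graph n → ℕ → Fin n → Fin n → Set
DistLe G i u v = ∃ λ k → k ≤ i × Walk G k u v

degree : ∀ {n} → Graph n → Fin n → ℕ
degree G v = ∣ tabulate (adj G v) ∣

maxDegree : ∀ {n} → Graph n → ℕ
maxDegree {n} G = foldr _⊔_ 0 (map (degree G) (allFin n))

Independent : ∀ {n} → Graph n → Subset n → Set
Independent G S = ∀ u v → u ∈ S → v ∈ S → adj G u v ≡ false

IsIndependenceNumber : ∀ {n} → Graph n → ℕ → Set
IsIndependenceNumber {n} G a =
  (Σ (Subset n) λ S → Independent G S × ∣ S ∣ ≡ a) ×
  (∀ (S : Subset n) → Independent G S → ∣ S ∣ ≤ a)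

-- c : V → Fin k, where colour j ∈ Fin k stands for class V_{j+1},
-- which must be a (j+1)-packing.
IsPackingColouring : ∀ {n} → Graph n → (k : ℕ) → (Fin n → Fin k) → Set
IsPackingColouring G k c =
  ∀ u v → u ≢ v → c u ≡ c v → ¬ DistLe G (suc (toℕ (c u))) u v

HasPackingColouring : ∀ {n} → Graph n → ℕ → Set
HasPackingColouring {n} G k = Σ (Fin n → Fin k) (IsPackingColouring G k)

IsPackingChromaticNumber : ∀ {n} → Graph n → ℕ → Set
IsPackingChromaticNumber G k =
  HasPackingColouring G k × (∀ m → HasPackingColouring G m → k ≤ m)

-- The class 𝓗, described directly on the vertex set of G.
-- part v = 0 : v belongs to A (w is the identified vertex a = b),
-- part v = 1 : v belongs to B ∖ {b},
-- part v = 2 : v = z.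
data Part : Set where
  inA inB inZ : Part

record HWitness {n : ℕ} (G : Graph n) : Set where
  field
    part : Fin n → Part
    a₁ a₂ w b₁ z : Fin n
    a₁≢a₂ : a₁ ≢ a₂
    a₁≢w  : a₁ ≢ w
    a₂≢w  : a₂ ≢ w
    a₁∈A  : part a₁ ≡ inA
    a₂∈A  : part a₂ ≡ inA
    w∈A   : part w ≡ inA
    b₁∈B  : part b₁ ≡ inB
    z∈Z   : part z ≡ inZ
    Z-only-z : ∀ v → part v ≡ inZ → v ≡ z
    A-clique : ∀ u v → part u ≡ inA → part v ≡ inA → u ≢ v → Adj G u v
    -- B = (B ∖ {b}) ∪ {w} is a clique
    B-clique : ∀ u v → part u ≡ inB → part v ≡ inB → u ≢ v → Adj G u v
    w-B      : ∀ v → part v ≡ inB → Adj G w v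
    z-adj    : ∀ v → part v ≡ inB → Adj G z v
    z-nonadj : ∀ v → part v ≢ inB → adj G z v ≡ false
    a₂-nonadj : ∀ v → part v ≢ inA → adj G a₂ v ≡ false
    a₁b₁ : adj G a₁ b₁ ≡ false

InH : ∀ {n} → Graph n → Set
InH G = HWitness G

module Submission where

-- With α(G) = 2 every colour class has at most two vertices,
-- so n ≤ χ_ρ + (number of repeated colours); a repeated colour i needs two
-- vertices at distance > i + 1, so diameter ≤ d + 1 gives n ≤ χ_ρ + d.  Also
-- a vertex whose neighbourhood is a clique forces χ_ρ ≥ degree + 1.
-- Upper bounds.  Merging colour classes of an injective colouring shows
-- χ_ρ ≤ n - 1 given a non-adjacent pair, and χ_ρ ≤ n - 2 given moreover a
-- second pair at distance ≥ 3.
-- Structure.  If d(u,v) ≥ 3 then N[u], N[v] are cliques partitioning V(G);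
-- a vertex adjacent to all but v then exhibits G as a member of 𝓗.

open import Defs
open import Data.Nat using (ℕ; suc; _+_; _≤_; _<_; z≤n; s≤s; _⊔_)
import Data.Nat.Properties as ℕ
open import Data.Bool as Bool using (Bool; true; false)
open import Data.Bool.Properties using (not-¬; ¬-not)
open import Data.Fin as Fin using (Fin; toℕ; punchOut; _↑ˡ_; _↑ʳ_)
open import Data.Fin.Permutation.Components using (transpose; transpose-inverse)
import Data.Fin.Properties as FinP
open import Data.Fin.Subset using (Subset; Nonempty; _∈_; _∉_; ∣_∣; ⊤; ⁅_⁆; _-_; inside; outside)
open import Data.Fin.Subset.Properties
open import Data.Vec using ([]; _∷_; tabulate; here; there)
import Data.Vec.Properties as VecP
open import Data.List using (List; []; _∷_; foldr; map; allFin)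
open import Data.List.Membership.Propositional using () renaming (_∈_ to _∈ₗ_)
open import Data.List.Membership.Propositional.Properties using (∈-allFin)
import Data.List.Relation.Unary.Any as Any
open import Data.Product using (Σ; ∃; _×_; _,_; proj₁; proj₂)
open import Data.Sum using (_⊎_; inj₁; inj₂)
open import Data.Empty using (⊥; ⊥-elim)
open import Relation.Nullary using (¬_; ¬?; Dec; yes; no; does)
open import Relation.Nullary.Decidable using (dec-true; dec-false; _×-dec_; _⊎-dec_)
open import Relation.Binary.Definitions using (tri<; tri≈; tri>)
open import Relation.Binary.PropositionalEquality
open import Function.Bundles using (_⇔_; mk⇔)
open import Function using (_∘′_)

module _ {n : ℕ} (G : Graph n) where

  snoc-walk : ∀ {k u v w} → Walk G k u v → Adj G v w → Walk G (suc k) u w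
  snoc-walk here         e = step e here
  snoc-walk (step e′ p) e = step e′ (snoc-walk p e)

  reverse-walk : ∀ {k u v} → Walk G k u v → Walk G k v u
  reverse-walk here                = here
  reverse-walk (step {v = x} e p) = snoc-walk (reverse-walk p) (trans (adj-sym G x _) e)

  append-walk : ∀ {i j u v w} → Walk G i u v → Walk G j v w → Walk G (i + j) u w
  append-walk here       q = q
  append-walk (step e p) q = step e (append-walk p q)

  dist-refl : ∀ {i u} → DistLe G i u u
  dist-refl = 0 , z≤n , here

  dist-adj : ∀ {u v} → Adj G u v → DistLe G 1 u v
  dist-adj e = 1 , s≤s z≤n , step e here

  dist-mono : ∀ {i j u v} → i ≤ j → DistLe G i u v → DistLe G j u v
  dist-mono i≤j (k , k≤i , p) = k , ℕ.≤-trans k≤i i≤j , p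

  dist-sym : ∀ {i u v} → DistLe G i u v → DistLe G i v u
  dist-sym (k , k≤i , p) = k , k≤i , reverse-walk p

  dist-trans : ∀ {i j u v w} → DistLe G i u v → DistLe G j v w → DistLe G (i + j) u w
  dist-trans (k , k≤i , p) (l , l≤j , q) = k + l , ℕ.+-mono-≤ k≤i l≤j , append-walk p q

  adj⇒≢ : ∀ {u v} → Adj G u v → u ≢ v
  adj⇒≢ {u} e refl = not-¬ e (irrefl G u)

  neighbour≢nonneighbour : ∀ {v t y} → Adj G v t → adj G v y ≡ false → t ≢ y
  neighbour≢nonneighbour e f refl = not-¬ e f

  far⇒≢ : ∀ {i u v} → ¬ DistLe G i u v → u ≢ v
  far⇒≢ far refl = far dist-refl

  far⇒nonadjacent : ∀ {i u v} → 1 ≤ i → ¬ DistLe G i u v → adj G u v ≡ false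
  far⇒nonadjacent 1≤i far = ¬-not λ e → far (dist-mono 1≤i (dist-adj e))

  far⇒no-common-neighbour : ∀ {i u v x} → 2 ≤ i → ¬ DistLe G i u v →
                            Adj G u x → Adj G v x → ⊥
  far⇒no-common-neighbour {v = v} {x} 2≤i far ux vx =
    far (dist-mono 2≤i (dist-trans (dist-adj ux) (dist-adj (trans (adj-sym G x v) vx))))

  nonadjacent⇒far : ∀ {u v} → u ≢ v → adj G u v ≡ false → ¬ DistLe G 1 u v
  nonadjacent⇒far u≢v _  (_ , _ , here)            = u≢v refl
  nonadjacent⇒far _   na (_ , _ , step e here)     = not-¬ e na
  nonadjacent⇒far _   _  (_ , s≤s () , step _ (step _ _))

  no-common-neighbour⇒far : ∀ {u v} → u ≢ v → adj G u v ≡ false →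
                            (∀ x → Adj G u x → adj G x v ≡ false) → ¬ DistLe G 2 u v
  no-common-neighbour⇒far u≢v _  _  (_ , _ , here)                 = u≢v refl
  no-common-neighbour⇒far _   na _  (_ , _ , step e here)          = not-¬ e na
  no-common-neighbour⇒far _   _  nc (_ , _ , step e (step e′ here)) = not-¬ e′ (nc _ e)
  no-common-neighbour⇒far _   _  _  (_ , s≤s (s≤s ()) , step _ (step _ (step _ _)))

injection⇒∣≤∣ : ∀ {n m} (S : Subset n) (T : Subset m) (f : Fin n → Fin m) →
                (∀ t → t ∈ S → f t ∈ T) →
                (∀ t s → t ∈ S → s ∈ S → f t ≡ f s → t ≡ s) → ∣ S ∣ ≤ ∣ T ∣
injection⇒∣≤∣ []            T f maps inj = z≤n
injection⇒∣≤∣ (outside ∷ S) T f maps inj =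
  injection⇒∣≤∣ S T (λ t → f (Fin.suc t)) (λ t t∈S → maps (Fin.suc t) (there t∈S))
    (λ t s t∈S s∈S e → FinP.suc-injective (inj _ _ (there t∈S) (there s∈S) e))
injection⇒∣≤∣ (inside ∷ S) T f maps inj =
  ℕ.≤-trans (s≤s rest) (x∈p⇒∣p-x∣<∣p∣ (maps Fin.zero here))
  where
  -- the remaining elements land in T minus the image of zero
  rest : ∣ S ∣ ≤ ∣ T - f Fin.zero ∣
  rest = injection⇒∣≤∣ S (T - f Fin.zero) (λ t → f (Fin.suc t))
    (λ t t∈S → x∈p∧x≢y⇒x∈p-y (maps (Fin.suc t) (there t∈S))
                 (λ e → FinP.0≢1+n (sym (inj _ _ (there t∈S) here e))))
    (λ t s t∈S s∈S e → FinP.suc-injective (inj _ _ (there t∈S) (there s∈S) e))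

∣p-x∣+1 : ∀ {n} (p : Subset n) (x : Fin n) → x ∈ p → suc ∣ p - x ∣ ≡ ∣ p ∣
∣p-x∣+1 (inside ∷ p)  Fin.zero    here      = cong (λ q → suc ∣ q ∣) (p─⊥≡p p)
∣p-x∣+1 (outside ∷ p) (Fin.suc x) (there i) = ∣p-x∣+1 p x i
∣p-x∣+1 (inside ∷ p)  (Fin.suc x) (there i) = cong suc (∣p-x∣+1 p x i)

∈tabulate⁺ : ∀ {n} (b : Fin n → Bool) {t} → b t ≡ true → t ∈ tabulate b
∈tabulate⁺ b {t} e = VecP.lookup⇒[]= t (tabulate b) (trans (VecP.lookup∘tabulate b t) e)

∈tabulate⁻ : ∀ {n} (b : Fin n → Bool) {t} → t ∈ tabulate b → b t ≡ true
∈tabulate⁻ b {t} m = trans (sym (VecP.lookup∘tabulate b t)) (VecP.[]=⇒lookup m)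

nonempty : ∀ {n} (p : Subset n) → 0 < ∣ p ∣ → Nonempty p
nonempty {n} p 0<∣p∣ with nonempty? p
... | yes ne = ne
... | no  e  = ⊥-elim (ℕ.<⇒≢ 0<∣p∣ (sym (trans (cong ∣_∣ (Empty-unique e)) (∣⊥∣≡0 n))))

image : ∀ {m n} → (Fin m → Fin n) → Subset n
image f = tabulate (λ t → does (FinP.any? λ i → f i Fin.≟ t))

∈image⁺ : ∀ {m n} (f : Fin m → Fin n) i → f i ∈ image f
∈image⁺ f i = ∈tabulate⁺ _ (dec-true (FinP.any? λ j → f j Fin.≟ f i) (i , refl))

∈image⁻ : ∀ {m n} (f : Fin m → Fin n) {t} → t ∈ image f → ∃ λ i → f i ≡ t
∈image⁻ f {t} m with FinP.any? (λ i → f i Fin.≟ t) | ∈tabulate⁻ _ m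
... | yes found | _ = found

x∉p-x : ∀ {n} (p : Subset n) (x : Fin n) → x ∉ p - x
x∉p-x (_ ∷ p) (Fin.suc x) (there m) = x∉p-x p x m

∈p-x⇒≢ : ∀ {n} {p : Subset n} {x t : Fin n} → t ∈ p - x → t ≢ x
∈p-x⇒≢ {p = p} {x} m refl = x∉p-x p x m

∣⊤-x∣ : ∀ {n} (x : Fin n) → suc ∣ ⊤ - x ∣ ≡ n
∣⊤-x∣ {n} x = trans (∣p-x∣+1 ⊤ x ∈⊤) (∣⊤∣≡n n)

∣⊤-x-y∣ : ∀ {n} (x y : Fin n) → y ≢ x → suc (suc ∣ ⊤ - x - y ∣) ≡ n
∣⊤-x-y∣ x y y≢x = trans (cong suc (∣p-x∣+1 (⊤ - x) y (x∈p∧x≢y⇒x∈p-y ∈⊤ y≢x))) (∣⊤-x∣ x)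

∣⊤-x-y-z∣ : ∀ {n} (x y z : Fin n) → y ≢ x → z ≢ x → z ≢ y →
            suc (suc (suc ∣ ⊤ - x - y - z ∣)) ≡ n
∣⊤-x-y-z∣ x y z y≢x z≢x z≢y =
  trans (cong (λ m → suc (suc m))
               (∣p-x∣+1 (⊤ - x - y) z (x∈p∧x≢y⇒x∈p-y (x∈p∧x≢y⇒x∈p-y ∈⊤ z≢x) z≢y)))
        (∣⊤-x-y∣ x y y≢x)

module _ {n : ℕ} (G : Graph n) where

  nbhd : Fin n → Subset n
  nbhd v = tabulate (adj G v)

  ∈nbhd⁺ : ∀ {v t} → Adj G v t → t ∈ nbhd v
  ∈nbhd⁺ = ∈tabulate⁺ (adj G _)

  ∈nbhd⁻ : ∀ {v t} → t ∈ nbhd v → Adj G v t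
  ∈nbhd⁻ = ∈tabulate⁻ (adj G _)

  degree≤ : ∀ v (T : Subset n) → (∀ t → Adj G v t → t ∈ T) → degree G v ≤ ∣ T ∣
  degree≤ v T h = p⊆q⇒∣p∣≤∣q∣ (λ m → h _ (∈nbhd⁻ m))

  degree≥ : ∀ v (T : Subset n) → (∀ t → t ∈ T → Adj G v t) → ∣ T ∣ ≤ degree G v
  degree≥ v T h = p⊆q⇒∣p∣≤∣q∣ (λ m → ∈nbhd⁺ (h _ m))

  degree<n : ∀ v → suc (degree G v) ≤ n
  degree<n v = subst (suc (degree G v) ≤_) (∣⊤-x∣ v)
    (s≤s (degree≤ v (⊤ - v) λ t e → x∈p∧x≢y⇒x∈p-y ∈⊤ (adj⇒≢ G e ∘′ sym)))

  degree-nonneighbour : ∀ v y → y ≢ v → adj G v y ≡ false → suc (suc (degree G v)) ≤ n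
  degree-nonneighbour v y y≢v vy = subst (suc (suc (degree G v)) ≤_) (∣⊤-x-y∣ v y y≢v)
    (s≤s (s≤s (degree≤ v (⊤ - v - y) λ t e →
      x∈p∧x≢y⇒x∈p-y (x∈p∧x≢y⇒x∈p-y ∈⊤ (adj⇒≢ G e ∘′ sym)) (neighbour≢nonneighbour G e vy))))

  degree-two-nonneighbours : ∀ v y z → y ≢ v → z ≢ v → z ≢ y →
    adj G v y ≡ false → adj G v z ≡ false → suc (suc (suc (degree G v))) ≤ n
  degree-two-nonneighbours v y z y≢v z≢v z≢y vy vz =
    subst (suc (suc (suc (degree G v))) ≤_) (∣⊤-x-y-z∣ v y z y≢v z≢v z≢y)
      (s≤s (s≤s (s≤s (degree≤ v (⊤ - v - y - z) λ t e →
        x∈p∧x≢y⇒x∈p-y (x∈p∧x≢y⇒x∈p-y (x∈p∧x≢y⇒x∈p-y ∈⊤ (adj⇒≢ G e ∘′ sym))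
                       (neighbour≢nonneighbour G e vy)) (neighbour≢nonneighbour G e vz)))))

  degree-n-2⇒unique-nonneighbour : ∀ w → degree G w + 2 ≡ n → ∀ a b → a ≢ w → b ≢ w →
                                    adj G w a ≡ false → adj G w b ≡ false → a ≡ b
  degree-n-2⇒unique-nonneighbour w deg a b a≢w b≢w wa wb with a Fin.≟ b
  ... | yes a≡b = a≡b
  ... | no  a≢b = ⊥-elim (ℕ.<-irrefl refl (subst (suc (suc (suc (degree G w))) ≤_) (sym deg′)
                    (degree-two-nonneighbours w a b a≢w b≢w (a≢b ∘′ sym) wa wb)))
    where
    deg′ : suc (suc (degree G w)) ≡ n
    deg′ = trans (ℕ.+-comm 2 (degree G w)) deg

  degree-all-but-one : ∀ v z → z ≢ v → (∀ t → t ≢ v → t ≢ z → Adj G v t) →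
                       n ≤ suc (suc (degree G v))
  degree-all-but-one v z z≢v h = subst (_≤ suc (suc (degree G v))) (∣⊤-x-y∣ v z z≢v)
    (s≤s (s≤s (degree≥ v (⊤ - v - z) λ t m →
      h t (∈p-x⇒≢ (p─q⊆p _ _ m)) (∈p-x⇒≢ m))))

module _ {A : Set} (f : A → ℕ) where

  listMax : List A → ℕ
  listMax xs = foldr _⊔_ 0 (map f xs)

  ≤listMax : ∀ {x} xs → x ∈ₗ xs → f x ≤ listMax xs
  ≤listMax (y ∷ xs) (Any.here refl) = ℕ.m≤m⊔n (f y) _
  ≤listMax (y ∷ xs) (Any.there m)   = ℕ.≤-trans (≤listMax xs m) (ℕ.m≤n⊔m (f y) _)

  listMax≤ : ∀ d xs → (∀ x → f x ≤ d) → listMax xs ≤ d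
  listMax≤ d []       h = z≤n
  listMax≤ d (y ∷ xs) h = ℕ.⊔-lub (h y) (listMax≤ d xs h)

  listMax-attained : ∀ xs → listMax xs ≡ 0 ⊎ ∃ λ x → f x ≡ listMax xs
  listMax-attained []       = inj₁ refl
  listMax-attained (y ∷ xs) with ℕ.⊔-sel (f y) (listMax xs)
  ... | inj₁ e = inj₂ (y , sym e)
  ... | inj₂ e with listMax-attained xs
  ...   | inj₁ z        = inj₁ (trans e z)
  ...   | inj₂ (x , fx) = inj₂ (x , trans fx (sym e))

module _ {n : ℕ} (G : Graph n) where

  degree≤Δ : ∀ v → degree G v ≤ maxDegree G
  degree≤Δ v = ≤listMax (degree G) (allFin n) (∈-allFin v)

  Δ≤ : ∀ d → (∀ v → degree G v ≤ d) → maxDegree G ≤ d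
  Δ≤ d h = listMax≤ (degree G) d (allFin n) h

  Δ-attained : Fin n → ∃ λ w → degree G w ≡ maxDegree G
  Δ-attained v with listMax-attained (degree G) (allFin n)
  ... | inj₂ r = r
  ... | inj₁ Δ≡0 = v , ℕ.≤-antisym (degree≤Δ v) (subst (_≤ degree G v) (sym Δ≡0) z≤n)

module _ {n : ℕ} (G : Graph n) {a : ℕ} (α : IsIndependenceNumber G a) where

  independent-family≤α : ∀ {m} (f : Fin m → Fin n) → (∀ i j → f i ≡ f j → i ≡ j) →
                         (∀ i j → adj G (f i) (f j) ≡ false) → m ≤ a
  independent-family≤α {m} f inj nonadj = begin
    m              ≡⟨ ∣⊤∣≡n m ⟨
    ∣ ⊤ {m} ∣      ≤⟨ injection⇒∣≤∣ ⊤ (image f) f (λ i _ → ∈image⁺ f i) (λ i j _ _ → inj i j) ⟩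
    ∣ image f ∣    ≤⟨ proj₂ α (image f) independent ⟩
    a              ∎
    where
    open ℕ.≤-Reasoning
    independent : Independent G (image f)
    independent u v u∈ v∈ with ∈image⁻ f u∈ | ∈image⁻ f v∈
    ... | i , refl | j , refl = nonadj i j

module _ {n : ℕ} (G : Graph n) (α : IsIndependenceNumber G 2) where

  no-independent-triple : ∀ {u v x} → u ≢ v → u ≢ x → v ≢ x →
    adj G u v ≡ false → adj G u x ≡ false → adj G v x ≡ false → ⊥
  no-independent-triple {u} {v} {x} u≢v u≢x v≢x uv ux vx =
    ℕ.<-irrefl refl (independent-family≤α G α triple injective nonadjacent)
    where
    triple : Fin 3 → Fin n
    triple Fin.zero                       = u
    triple (Fin.suc Fin.zero)             = v
    triple (Fin.suc (Fin.suc Fin.zero))   = x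
    injective : ∀ i j → triple i ≡ triple j → i ≡ j
    injective Fin.zero Fin.zero _ = refl
    injective Fin.zero (Fin.suc Fin.zero) e = ⊥-elim (u≢v e)
    injective Fin.zero (Fin.suc (Fin.suc Fin.zero)) e = ⊥-elim (u≢x e)
    injective (Fin.suc Fin.zero) Fin.zero e = ⊥-elim (u≢v (sym e))
    injective (Fin.suc Fin.zero) (Fin.suc Fin.zero) _ = refl
    injective (Fin.suc Fin.zero) (Fin.suc (Fin.suc Fin.zero)) e = ⊥-elim (v≢x e)
    injective (Fin.suc (Fin.suc Fin.zero)) Fin.zero e = ⊥-elim (u≢x (sym e))
    injective (Fin.suc (Fin.suc Fin.zero)) (Fin.suc Fin.zero) e = ⊥-elim (v≢x (sym e))
    injective (Fin.suc (Fin.suc Fin.zero)) (Fin.suc (Fin.suc Fin.zero)) _ = refl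
    flip : ∀ {s t} → adj G s t ≡ false → adj G t s ≡ false
    flip {s} {t} f = trans (adj-sym G t s) f
    nonadjacent : ∀ i j → adj G (triple i) (triple j) ≡ false
    nonadjacent Fin.zero Fin.zero = irrefl G u
    nonadjacent Fin.zero (Fin.suc Fin.zero) = uv
    nonadjacent Fin.zero (Fin.suc (Fin.suc Fin.zero)) = ux
    nonadjacent (Fin.suc Fin.zero) Fin.zero = flip uv
    nonadjacent (Fin.suc Fin.zero) (Fin.suc Fin.zero) = irrefl G v
    nonadjacent (Fin.suc Fin.zero) (Fin.suc (Fin.suc Fin.zero)) = vx
    nonadjacent (Fin.suc (Fin.suc Fin.zero)) Fin.zero = flip ux
    nonadjacent (Fin.suc (Fin.suc Fin.zero)) (Fin.suc Fin.zero) = flip vx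
    nonadjacent (Fin.suc (Fin.suc Fin.zero)) (Fin.suc (Fin.suc Fin.zero)) = irrefl G x

  nonadjacent-pair : ∃ λ p → ∃ λ q → p ≢ q × adj G p q ≡ false
  nonadjacent-pair with proj₁ α
  ... | S , independent , ∣S∣≡2 with nonempty S (subst (0 <_) (sym ∣S∣≡2) (s≤s z≤n))
  ...   | p , p∈S with nonempty (S - p) (ℕ.≤-reflexive (sym (ℕ.suc-injective (trans (∣p-x∣+1 S p p∈S) ∣S∣≡2))))
  ...     | q , q∈S-p = p , q , ∈p-x⇒≢ q∈S-p ∘′ sym , independent p q p∈S (p─q⊆p S ⁅ p ⁆ q∈S-p)

module PackingColouring {n : ℕ} (G : Graph n) {k : ℕ} (c : Fin n → Fin k)
                        (packing : IsPackingColouring G k c) where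

  same-colour⇒nonadjacent : ∀ {u v} → u ≢ v → c u ≡ c v → adj G u v ≡ false
  same-colour⇒nonadjacent u≢v e = far⇒nonadjacent G (s≤s z≤n) (packing _ _ u≢v e)

  -- If N(w) is a clique, the closed neighbourhood N[w] is a clique and so
  -- needs degree(w) + 1 distinct colours.
  clique-neighbourhood⇒degree<k : ∀ w → (∀ t s → Adj G w t → Adj G w s → t ≢ s → Adj G t s) →
                                  suc (degree G w) ≤ k
  clique-neighbourhood⇒degree<k w clique = subst (suc (degree G w) ≤_) (∣⊤-x∣ (c w))
    (s≤s (injection⇒∣≤∣ (nbhd G w) (⊤ - c w) c
      (λ t t∈N → x∈p∧x≢y⇒x∈p-y ∈⊤ (colour≢ (∈nbhd⁻ G t∈N)))
      (λ t s t∈N s∈N ct≡cs → distinct-colours (∈nbhd⁻ G t∈N) (∈nbhd⁻ G s∈N) ct≡cs)))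
    where
    colour≢ : ∀ {t} → Adj G w t → c t ≢ c w
    colour≢ e ct≡cw = not-¬ e (trans (adj-sym G _ _) (same-colour⇒nonadjacent (adj⇒≢ G e ∘′ sym) ct≡cw))
    distinct-colours : ∀ {t s} → Adj G w t → Adj G w s → c t ≡ c s → t ≡ s
    distinct-colours {t} {s} wt ws ct≡cs with t Fin.≟ s
    ... | yes t≡s = t≡s
    ... | no  t≢s = ⊥-elim (not-¬ (clique t s wt ws t≢s) (same-colour⇒nonadjacent t≢s ct≡cs))

-- Lower bounds when α(G) = 2.  Every colour class is independent, hence
-- has at most two vertices.  Sending the first vertex of each class to its
-- colour and the second one to a separate code for its (repeated) colour is
-- injective, so n ≤ k + (number of repeated colours).  A repeated colour i
-- needs two vertices at distance > i + 1, so a small diameter leaves few.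

module PackingLowerBound {n : ℕ} (G : Graph n) (α : IsIndependenceNumber G 2)
                         {k : ℕ} (c : Fin n → Fin k) (packing : IsPackingColouring G k c) where

  open PackingColouring G c packing

  at-most-two : ∀ {u v x} → u ≢ v → u ≢ x → v ≢ x → c u ≡ c v → c u ≡ c x → ⊥
  at-most-two u≢v u≢x v≢x uv ux =
    no-independent-triple G α u≢v u≢x v≢x (same-colour⇒nonadjacent u≢v uv)
      (same-colour⇒nonadjacent u≢x ux) (same-colour⇒nonadjacent v≢x (trans (sym uv) ux))

  Repeated : Fin k → Set
  Repeated i = ∃ λ u → ∃ λ v → u ≢ v × c u ≡ i × c v ≡ i

  Later : Fin n → Set
  Later t = ∃ λ s → toℕ s < toℕ t × c s ≡ c t

  later? : ∀ t → Dec (Later t)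
  later? t = FinP.any? (λ s → (toℕ s ℕ.<? toℕ t) ×-dec (c s Fin.≟ c t))

  <⇒≢ : ∀ {s t : Fin n} → toℕ s < toℕ t → s ≢ t
  <⇒≢ lt refl = ℕ.<-irrefl refl lt

  ↑ˡ≢↑ʳ : ∀ {m} (i : Fin k) (j : Fin m) → i ↑ˡ m ≢ k ↑ʳ j
  ↑ˡ≢↑ʳ {m} i j e with trans (sym (FinP.splitAt-↑ˡ k i m)) (trans (cong (Fin.splitAt k) e) (FinP.splitAt-↑ʳ k m j))
  ... | ()

  module _ {m : ℕ} (code : ∀ i → Repeated i → Fin m)
           (code-injective : ∀ i j ri rj → code i ri ≡ code j rj → i ≡ j) where

    encode : ∀ t → Dec (Later t) → Fin (k + m)
    encode t (no  _)              = c t ↑ˡ m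
    encode t (yes (s , s<t , cs)) = k ↑ʳ code (c t) (s , t , <⇒≢ s<t , cs , refl)

    -- Two later vertices with the same colour would form a triple with
    -- the earlier vertex of one of them.
    later-unique : ∀ {t t′ s s′} → toℕ s < toℕ t → c s ≡ c t → toℕ s′ < toℕ t′ → c s′ ≡ c t′ →
                   c t ≡ c t′ → t ≡ t′
    later-unique {t} {t′} {s} {s′} s<t cs s′<t′ cs′ ct with t Fin.≟ t′ | s Fin.≟ t′
    ... | yes t≡t′ | _ = t≡t′
    ... | no t≢t′ | no s≢t′ = ⊥-elim (at-most-two (<⇒≢ s<t) s≢t′ t≢t′ cs (trans cs ct))
    ... | no t≢t′ | yes refl =
      ⊥-elim (at-most-two (<⇒≢ s′<t′) (<⇒≢ (ℕ.<-trans s′<t′ s<t)) (t≢t′ ∘′ sym) cs′ (trans cs′ (sym ct)))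

    encode-injective : ∀ t t′ (d : Dec (Later t)) (d′ : Dec (Later t′)) →
                       encode t d ≡ encode t′ d′ → t ≡ t′
    encode-injective t t′ (no first) (no first′) e with ℕ.<-cmp (toℕ t) (toℕ t′)
    ... | tri< lt _ _ = ⊥-elim (first′ (t , lt , FinP.↑ˡ-injective m _ _ e))
    ... | tri≈ _ eq _ = FinP.toℕ-injective eq
    ... | tri> _ _ gt = ⊥-elim (first (t′ , gt , sym (FinP.↑ˡ-injective m _ _ e)))
    encode-injective t t′ (no _)  (yes _) e = ⊥-elim (↑ˡ≢↑ʳ _ _ e)
    encode-injective t t′ (yes _) (no _)  e = ⊥-elim (↑ˡ≢↑ʳ _ _ (sym e))
    encode-injective t t′ (yes (s , s<t , cs)) (yes (s′ , s′<t′ , cs′)) e =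
      later-unique s<t cs s′<t′ cs′ (code-injective _ _ _ _ (FinP.↑ʳ-injective k _ _ e))

    n≤k+codes : n ≤ k + m
    n≤k+codes = FinP.injective⇒≤ λ {t} {t′} → encode-injective t t′ (later? t) (later? t′)

  one-repeated : ∀ i₀ → (∀ i → Repeated i → toℕ i ≡ i₀) → n ≤ k + 1
  one-repeated i₀ h = n≤k+codes (λ _ _ → Fin.zero) λ i j ri rj _ →
    FinP.toℕ-injective (trans (h i ri) (sym (h j rj)))

  repeated-below : ∀ d → (∀ i → Repeated i → toℕ i < d) → n ≤ k + d
  repeated-below d h = n≤k+codes (λ i ri → Fin.fromℕ< (h i ri)) λ i j ri rj e →
    FinP.toℕ-injective (trans (sym (FinP.toℕ-fromℕ< (h i ri)))
                              (trans (cong toℕ e) (FinP.toℕ-fromℕ< (h j rj))))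

  -- If G has diameter at most d + 1, only the colours below d can repeat.
  diameter-bound : ∀ d → (∀ u v → DistLe G (suc d) u v) → n ≤ k + d
  diameter-bound d D = repeated-below d repeated<d
    where
    repeated<d : ∀ i → Repeated i → toℕ i < d
    repeated<d i (u , v , u≢v , refl , cv) with toℕ (c u) ℕ.<? d
    ... | yes lt = lt
    ... | no ≮d  = ⊥-elim (packing u v u≢v (sym cv) (dist-mono G (s≤s (ℕ.≮⇒≥ ≮d)) (D u v)))

  repeated-avoiding : ∀ i₀ → suc (k + 1) ≤ n →
                      ∃ λ u → ∃ λ v → u ≢ v × c u ≡ c v × toℕ (c u) ≢ i₀
  repeated-avoiding i₀ k+1<n
    with FinP.any? (λ u → FinP.any? (λ v →
           ¬? (u Fin.≟ v) ×-dec (c u Fin.≟ c v) ×-dec ¬? (toℕ (c u) ℕ.≟ i₀)))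
  ... | yes found = found
  ... | no none   = ⊥-elim (ℕ.<-irrefl refl (ℕ.≤-trans k+1<n (one-repeated i₀ only-i₀)))
    where
    only-i₀ : ∀ i → Repeated i → toℕ i ≡ i₀
    only-i₀ i (u , v , u≢v , refl , cv) with toℕ (c u) ℕ.≟ i₀
    ... | yes e  = e
    ... | no  ≢i₀ = ⊥-elim (none (u , v , u≢v , sym cv , ≢i₀))

-- Upper bounds on χ_ρ come from merging colour classes of an injective
-- colouring, which is a packing colouring since no class has two vertices.
injective⇒packing : ∀ {n} (G : Graph n) {k} (c : Fin n → Fin k) →
                    (∀ u v → c u ≡ c v → u ≡ v) → IsPackingColouring G k c
injective⇒packing G c inj u v u≢v cu≡cv = ⊥-elim (u≢v (inj u v cu≡cv))

-- Transpositions of Fin n, used to move chosen vertices to small colours.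
transpose-left : ∀ {n} (i j : Fin n) → transpose i j i ≡ j
transpose-left i j rewrite dec-true (i Fin.≟ i) refl = refl

transpose-other : ∀ {n} {i j k : Fin n} → k ≢ i → k ≢ j → transpose i j k ≡ k
transpose-other {i = i} {j} {k} k≢i k≢j
  rewrite dec-false (k Fin.≟ i) k≢i | dec-false (k Fin.≟ j) k≢j = refl

transpose-injective : ∀ {n} (i j : Fin n) {x y} → transpose i j x ≡ transpose i j y → x ≡ y
transpose-injective i j {x} {y} e =
  trans (sym (transpose-inverse j i)) (trans (cong (transpose j i) e) (transpose-inverse j i))

toℕ-punchOut≤ : ∀ {K} {j x : Fin (suc K)} (j≢x : j ≢ x) → toℕ (punchOut j≢x) ≤ toℕ x
toℕ-punchOut≤ {_}     {Fin.zero}  {Fin.zero}  j≢x = ⊥-elim (j≢x refl)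
toℕ-punchOut≤ {_}     {Fin.zero}  {Fin.suc x} j≢x = ℕ.n≤1+n (toℕ x)
toℕ-punchOut≤ {suc K} {Fin.suc j} {Fin.zero}  j≢x = z≤n
toℕ-punchOut≤ {suc K} {Fin.suc j} {Fin.suc x} j≢x = s≤s (toℕ-punchOut≤ (j≢x ∘′ cong Fin.suc))

toℕ-punchOut< : ∀ {K} {j x : Fin (suc K)} (j≢x : j ≢ x) → toℕ x < toℕ j → toℕ (punchOut j≢x) ≡ toℕ x
toℕ-punchOut< {suc K} {Fin.suc j} {Fin.zero}  j≢x x<j       = refl
toℕ-punchOut< {suc K} {Fin.suc j} {Fin.suc x} j≢x (s≤s x<j) =
  cong suc (toℕ-punchOut< (j≢x ∘′ cong Fin.suc) x<j)

-- merge j i sends index j to (the image of) i and renumbers the indices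
-- above j one step down.
merge : ∀ {K} (j i : Fin (suc K)) → j ≢ i → Fin (suc K) → Fin K
merge j i j≢i x with j Fin.≟ x
... | yes _   = punchOut j≢i
... | no  j≢x = punchOut j≢x

module _ {K : ℕ} (j i : Fin (suc K)) (j≢i : j ≢ i) where

  merge-identifies : merge j i j≢i j ≡ merge j i j≢i i
  merge-identifies with j Fin.≟ j | j Fin.≟ i
  ... | yes _ | yes j≡i = ⊥-elim (j≢i j≡i)
  ... | yes _ | no  _   = FinP.punchOut-cong j refl
  ... | no j≢j | _      = ⊥-elim (j≢j refl)

  merge-below : ∀ x → toℕ x < toℕ j → toℕ (merge j i j≢i x) ≡ toℕ x
  merge-below x x<j with j Fin.≟ x
  ... | yes refl = ⊥-elim (ℕ.<-irrefl refl x<j)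
  ... | no  j≢x  = toℕ-punchOut< j≢x x<j

  merge-≤ : toℕ i < toℕ j → ∀ x → toℕ (merge j i j≢i x) ≤ toℕ x
  merge-≤ i<j x with j Fin.≟ x
  ... | yes refl = ℕ.≤-trans (ℕ.≤-reflexive (toℕ-punchOut< j≢i i<j)) (ℕ.<⇒≤ i<j)
  ... | no  j≢x  = toℕ-punchOut≤ j≢x

  merge-fibre : ∀ x y → merge j i j≢i x ≡ merge j i j≢i y →
                x ≡ y ⊎ ((x ≡ i ⊎ x ≡ j) × (y ≡ i ⊎ y ≡ j))
  merge-fibre x y e with j Fin.≟ x | j Fin.≟ y
  ... | yes j≡x | yes j≡y = inj₁ (trans (sym j≡x) j≡y)
  ... | yes j≡x | no  j≢y = inj₂ (inj₂ (sym j≡x) , inj₁ (sym (FinP.punchOut-injective j≢i j≢y e)))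
  ... | no  j≢x | yes j≡y = inj₂ (inj₁ (FinP.punchOut-injective j≢x j≢i e) , inj₂ (sym j≡y))
  ... | no  j≢x | no  j≢y = inj₁ (FinP.punchOut-injective j≢x j≢y e)

  merge-merged : toℕ i < toℕ j → ∀ x → x ≡ i ⊎ x ≡ j → toℕ (merge j i j≢i x) ≡ toℕ i
  merge-merged i<j x (inj₁ refl) = merge-below i i<j
  merge-merged i<j x (inj₂ refl) = trans (cong toℕ merge-identifies) (merge-below i i<j)

-- Merging two classes i < j of a packing colouring that are mutually at
-- distance > i + 1 gives a packing colouring with one colour fewer: the
-- merged class gets colour i and every other class a colour no larger.
merge-packing : ∀ {n} (G : Graph n) {K} (c : Fin n → Fin (suc K)) →
  IsPackingColouring G (suc K) c → (j i : Fin (suc K)) (j≢i : j ≢ i) → toℕ i < toℕ j →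
  (∀ u v → c u ≡ i → c v ≡ j → ¬ DistLe G (suc (toℕ i)) u v) →
  IsPackingColouring G K (λ v → merge j i j≢i (c v))
merge-packing G c packing j i j≢i i<j apart u v u≢v e with c u Fin.≟ c v
... | yes cu≡cv = λ d →
  packing u v u≢v cu≡cv (dist-mono G (s≤s (merge-≤ j i j≢i i<j (c u))) d)
... | no cu≢cv with merge-fibre j i j≢i (c u) (c v) e
...   | inj₁ cu≡cv = ⊥-elim (cu≢cv cu≡cv)
...   | inj₂ (inj₁ cu≡i , inj₁ cv≡i) = ⊥-elim (cu≢cv (trans cu≡i (sym cv≡i)))
...   | inj₂ (inj₂ cu≡j , inj₂ cv≡j) = ⊥-elim (cu≢cv (trans cu≡j (sym cv≡j)))
...   | inj₂ (inj₁ cu≡i , inj₂ cv≡j) =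
  subst (λ d → ¬ DistLe G (suc d) u v) (sym (merge-merged j i j≢i i<j (c u) (inj₁ cu≡i)))
        (apart u v cu≡i cv≡j)
...   | inj₂ (inj₂ cu≡j , inj₁ cv≡i) =
  subst (λ d → ¬ DistLe G (suc d) u v) (sym (merge-merged j i j≢i i<j (c u) (inj₂ cu≡j)))
        (λ d → apart v u cv≡i cu≡j (dist-sym G d))

≢0,1⇒2≤ : ∀ {K} {x a b : Fin K} → toℕ a ≡ 0 → toℕ b ≡ 1 → x ≢ a → x ≢ b → 2 ≤ toℕ x
≢0,1⇒2≤ {x = x} a≡0 b≡1 x≢a x≢b with toℕ x in eq
... | 0           = ⊥-elim (x≢a (FinP.toℕ-injective (trans eq (sym a≡0))))
... | 1           = ⊥-elim (x≢b (FinP.toℕ-injective (trans eq (sym b≡1))))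
... | suc (suc _) = s≤s (s≤s z≤n)

-- Start from an injective colouring σ giving p colour 0 and merge the
-- classes of p and of a non-neighbour q: p and q share colour 0 and every
-- other vertex keeps a colour of its own.
module MergeNonadjacentPair {n : ℕ} (G : Graph n) {K : ℕ} (σ : Fin n → Fin (suc K))
       (σ-injective : ∀ u v → σ u ≡ σ v → u ≡ v) {p q : Fin n} (σp≡0 : σ p ≡ Fin.zero)
       (p≢q : p ≢ q) (pq : adj G p q ≡ false) where

  σq≢0 : σ q ≢ Fin.zero
  σq≢0 e = p≢q (σ-injective p q (trans σp≡0 (sym e)))

  colouring : Fin n → Fin K
  colouring v = merge (σ q) Fin.zero σq≢0 (σ v)

  colouring-packing : IsPackingColouring G K colouring
  colouring-packing = merge-packing G σ (injective⇒packing G σ σ-injective) (σ q) Fin.zero σq≢0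
    (ℕ.n≢0⇒n>0 (σq≢0 ∘′ FinP.toℕ-injective)) apart
    where
    apart : ∀ u v → σ u ≡ Fin.zero → σ v ≡ σ q → ¬ DistLe G 1 u v
    apart u v σu σv with σ-injective u p (trans σu (sym σp≡0)) | σ-injective v q σv
    ... | refl | refl = nonadjacent⇒far G p≢q pq

  colouring-fibre : ∀ u v → colouring u ≡ colouring v → u ≡ v ⊎ ((u ≡ p ⊎ u ≡ q) × (v ≡ p ⊎ v ≡ q))
  colouring-fibre u v e with merge-fibre (σ q) Fin.zero σq≢0 (σ u) (σ v) e
  ... | inj₁ σu≡σv         = inj₁ (σ-injective u v σu≡σv)
  ... | inj₂ (σu∈ , σv∈) = inj₂ (back u σu∈ , back v σv∈)
    where
    back : ∀ x → σ x ≡ Fin.zero ⊎ σ x ≡ σ q → x ≡ p ⊎ x ≡ q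
    back x (inj₁ σx≡0)  = inj₁ (σ-injective x p (trans σx≡0 (sym σp≡0)))
    back x (inj₂ σx≡σq) = inj₂ (σ-injective x q σx≡σq)

  colouring-below : ∀ v → toℕ (σ v) < toℕ (σ q) → toℕ (colouring v) ≡ toℕ (σ v)
  colouring-below v = merge-below (σ q) Fin.zero σq≢0 (σ v)

nonadjacent-pair⇒colouring : ∀ {n k} (G : Graph n) → suc k ≡ n → ∀ {p q} →
                             p ≢ q → adj G p q ≡ false → HasPackingColouring G k
nonadjacent-pair⇒colouring G refl {p} {q} p≢q pq = colouring , colouring-packing
  where
  open MergeNonadjacentPair G (transpose p Fin.zero) (λ u v → transpose-injective p Fin.zero)
                            (transpose-left p Fin.zero) p≢q pq

-- If moreover r, s are further vertices at distance > 2, they can share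
-- colour 1 as well, giving a packing colouring with n - 2 colours.
two-pairs⇒colouring : ∀ {n k} (G : Graph n) → suc (suc k) ≡ n → ∀ {p q r s} →
  p ≢ q → p ≢ r → p ≢ s → q ≢ r → q ≢ s → r ≢ s →
  adj G p q ≡ false → ¬ DistLe G 2 r s → HasPackingColouring G k
two-pairs⇒colouring G refl {p} {q} {r} {s} p≢q p≢r p≢s q≢r q≢s r≢s pq rs =
  (λ v → merge (c₁ s) (c₁ r) cs≢cr (c₁ v)) ,
  merge-packing G c₁ colouring-packing (c₁ s) (c₁ r) cs≢cr (subst (_< toℕ (c₁ s)) (sym cr≡1) 2≤cs) apart
  where
  -- σ: an injective colouring with σ p = 0 and σ r = 1
  τ : Fin _ → Fin _
  τ = transpose p Fin.zero
  σ : Fin _ → Fin _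
  σ v = transpose (τ r) (Fin.suc Fin.zero) (τ v)
  σ-injective : ∀ u v → σ u ≡ σ v → u ≡ v
  σ-injective u v e = transpose-injective p Fin.zero (transpose-injective (τ r) _ e)
  τr≢0 : τ r ≢ Fin.zero
  τr≢0 e = p≢r (transpose-injective p Fin.zero (trans (transpose-left p Fin.zero) (sym e)))
  σp≡0 : σ p ≡ Fin.zero
  σp≡0 = trans (cong (transpose (τ r) _) (transpose-left p Fin.zero))
               (transpose-other (τr≢0 ∘′ sym) (λ ()))
  σr≡1 : σ r ≡ Fin.suc Fin.zero
  σr≡1 = transpose-left (τ r) _

  open MergeNonadjacentPair G σ σ-injective σp≡0 p≢q pq renaming (colouring to c₁)

  not-p-or-q : ∀ {x} → p ≢ x → q ≢ x → ¬ (x ≡ p ⊎ x ≡ q)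
  not-p-or-q p≢x q≢x (inj₁ x≡p) = p≢x (sym x≡p)
  not-p-or-q p≢x q≢x (inj₂ x≡q) = q≢x (sym x≡q)

  alone : ∀ {x} → p ≢ x → q ≢ x → ∀ v → c₁ v ≡ c₁ x → v ≡ x
  alone {x} p≢x q≢x v e with colouring-fibre v x e
  ... | inj₁ v≡x       = v≡x
  ... | inj₂ (_ , x∈) = ⊥-elim (not-p-or-q p≢x q≢x x∈)

  cp≡0 : toℕ (c₁ p) ≡ 0
  cp≡0 = trans (colouring-below p (subst (_< toℕ (σ q)) (sym (cong toℕ σp≡0))
                  (ℕ.n≢0⇒n>0 (σq≢0 ∘′ FinP.toℕ-injective))))
               (cong toℕ σp≡0)
  cr≡1 : toℕ (c₁ r) ≡ 1
  cr≡1 = trans (colouring-below r (subst (_< toℕ (σ q)) (sym (cong toℕ σr≡1))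
                  (≢0,1⇒2≤ (cong toℕ σp≡0) (cong toℕ σr≡1)
                     (p≢q ∘′ sym ∘′ σ-injective q p) (q≢r ∘′ σ-injective q r))))
               (cong toℕ σr≡1)
  cs≢cr : c₁ s ≢ c₁ r
  cs≢cr e = r≢s (sym (alone p≢r q≢r s e))
  2≤cs : 2 ≤ toℕ (c₁ s)
  2≤cs = ≢0,1⇒2≤ cp≡0 cr≡1 (p≢s ∘′ alone p≢s q≢s p ∘′ sym) cs≢cr

  apart : ∀ u v → c₁ u ≡ c₁ r → c₁ v ≡ c₁ s → ¬ DistLe G (suc (toℕ (c₁ r))) u v
  apart u v cu cv rewrite alone p≢r q≢r u cu | alone p≢s q≢s v cv | cr≡1 = rs

ClosedNbhd : ∀ {n} → Graph n → Fin n → Fin n → Set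
ClosedNbhd G u t = t ≡ u ⊎ Adj G u t

closedNbhd? : ∀ {n} (G : Graph n) u t → Dec (ClosedNbhd G u t)
closedNbhd? G u t = (t Fin.≟ u) ⊎-dec (adj G u t Bool.≟ true)

module _ {n : ℕ} (G : Graph n) {u v : Fin n} (far : ¬ DistLe G 2 u v) where

  far-disjoint : ∀ {t} → ClosedNbhd G u t → ClosedNbhd G v t → ⊥
  far-disjoint (inj₁ refl) (inj₁ refl) = far⇒≢ G far refl
  far-disjoint (inj₁ refl) (inj₂ vt)   = not-¬ vt (trans (adj-sym G v _) (far⇒nonadjacent G (s≤s z≤n) far))
  far-disjoint (inj₂ ut)   (inj₁ refl) = not-¬ ut (far⇒nonadjacent G (s≤s z≤n) far)
  far-disjoint (inj₂ ut)   (inj₂ vt)   = far⇒no-common-neighbour G (s≤s (s≤s z≤n)) far ut vt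

  -- A neighbour t of v is a non-neighbour of u besides v, so degree(u) ≤ n - 3.
  far⇒degree≤n-3 : ∀ {t} → Adj G v t → suc (suc (suc (degree G u))) ≤ n
  far⇒degree≤n-3 {t} vt = degree-two-nonneighbours G u v t (far⇒≢ G far ∘′ sym)
    (λ t≡u → far-disjoint (inj₁ t≡u) (inj₂ vt)) (adj⇒≢ G vt ∘′ sym)
    (far⇒nonadjacent G (s≤s z≤n) far) (¬-not λ ut → far-disjoint (inj₂ ut) (inj₂ vt))

module _ {n : ℕ} (G : Graph n) (α : IsIndependenceNumber G 2) {u v : Fin n} (far : ¬ DistLe G 2 u v) where

  far-cover : ∀ t → ClosedNbhd G u t ⊎ ClosedNbhd G v t
  far-cover t with closedNbhd? G u t | closedNbhd? G v t
  ... | yes ut | _      = inj₁ ut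
  ... | no _   | yes vt = inj₂ vt
  ... | no ¬ut | no ¬vt = ⊥-elim (no-independent-triple G α (far⇒≢ G far)
                            (¬ut ∘′ inj₁ ∘′ sym) (¬vt ∘′ inj₁ ∘′ sym)
                            (far⇒nonadjacent G (s≤s z≤n) far) (¬-not (¬ut ∘′ inj₂)) (¬-not (¬vt ∘′ inj₂)))

  far-clique : ∀ {t s} → ClosedNbhd G u t → ClosedNbhd G u s → t ≢ s → Adj G t s
  far-clique (inj₁ refl) (inj₁ refl) t≢s = ⊥-elim (t≢s refl)
  far-clique (inj₁ refl) (inj₂ us)   _   = us
  far-clique (inj₂ ut)   (inj₁ refl) _   = trans (adj-sym G _ _) ut
  far-clique {t} {s} (inj₂ ut) (inj₂ us) t≢s with adj G t s in ts
  ... | true  = refl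
  ... | false = ⊥-elim (no-independent-triple G α t≢s (not-v ut) (not-v us) ts (nonadj-v ut) (nonadj-v us))
    where
    not-v : ∀ {x} → Adj G u x → x ≢ v
    not-v ux refl = far-disjoint G far (inj₂ ux) (inj₁ refl)
    nonadj-v : ∀ {x} → Adj G u x → adj G x v ≡ false
    nonadj-v ux = ¬-not λ xv → far-disjoint G far (inj₂ ux) (inj₂ (trans (adj-sym G _ _) xv))

module _ {n : ℕ} (G : Graph n) (α : IsIndependenceNumber G 2) {u v : Fin n} (far : ¬ DistLe G 2 u v) where

  CrossEdge : Set
  CrossEdge = ∃ λ p → ∃ λ q → ClosedNbhd G u p × ClosedNbhd G v q × Adj G p q

  cross-edge? : Dec CrossEdge
  cross-edge? = FinP.any? λ p → FinP.any? λ q →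
    closedNbhd? G u p ×-dec closedNbhd? G v q ×-dec (adj G p q Bool.≟ true)

  -- Without a cross edge every neighbourhood lies inside N[u] or N[v], hence is a clique.
  no-cross-edge⇒clique-neighbourhoods : ¬ CrossEdge →
    ∀ w → ∀ t s → Adj G w t → Adj G w s → t ≢ s → Adj G t s
  no-cross-edge⇒clique-neighbourhoods none w t s wt ws t≢s with far-cover G α far w
  ... | inj₁ uw = far-clique G α far (same-side uw wt) (same-side uw ws) t≢s
    where
    same-side : ∀ {r} → ClosedNbhd G u w → Adj G w r → ClosedNbhd G u r
    same-side {r} uw wr with far-cover G α far r
    ... | inj₁ ur = ur
    ... | inj₂ vr = ⊥-elim (none (w , r , uw , vr , wr))
  ... | inj₂ vw = far-clique G α (far ∘′ dist-sym G) (same-side vw wt) (same-side vw ws) t≢s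
    where
    same-side : ∀ {r} → ClosedNbhd G v w → Adj G w r → ClosedNbhd G v r
    same-side {r} vw wr with far-cover G α far r
    ... | inj₂ vr = vr
    ... | inj₁ ur = ⊥-elim (none (r , w , ur , vw , trans (adj-sym G r w) wr))

  -- A cross edge joins a neighbour of u to a neighbour of v, since its ends
  -- are not in both closed neighbourhoods.
  cross-edge-ends : ∀ {p q} → ClosedNbhd G u p → ClosedNbhd G v q → Adj G p q → Adj G u p × Adj G v q
  cross-edge-ends (inj₁ refl) vq pq = ⊥-elim (far-disjoint G far (inj₂ pq) vq)
  cross-edge-ends {p} (inj₂ up) (inj₁ refl) pq =
    ⊥-elim (far-disjoint G far (inj₂ up) (inj₂ (trans (adj-sym G v p) pq)))
  cross-edge-ends (inj₂ up) (inj₂ vq) _ = up , vq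

  -- ... and then every vertex is within distance 3 of every other: go to p
  -- inside the clique N[u], cross to q and move inside the clique N[v].
  module _ {p q : Fin n} (up : ClosedNbhd G u p) (vq : ClosedNbhd G v q) (pq : Adj G p q) where

    private
      to-p : ∀ {r} → ClosedNbhd G u r → DistLe G 1 r p
      to-p {r} ur with r Fin.≟ p
      ... | yes refl = dist-refl G
      ... | no r≢p   = dist-adj G (far-clique G α far ur up r≢p)

      from-q : ∀ {r} → ClosedNbhd G v r → DistLe G 1 q r
      from-q {r} vr with q Fin.≟ r
      ... | yes refl = dist-refl G
      ... | no q≢r   = dist-adj G (far-clique G α (far ∘′ dist-sym G) vq vr q≢r)

      across : ∀ {r r′} → ClosedNbhd G u r → ClosedNbhd G v r′ → DistLe G 3 r r′
      across ur vr′ = dist-trans G (dist-trans G (to-p ur) (dist-adj G pq)) (from-q vr′)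

    cross-edge⇒diameter≤3 : ∀ s t → DistLe G 3 s t
    cross-edge⇒diameter≤3 s t with far-cover G α far s | far-cover G α far t
    ... | inj₁ us | inj₁ ut = dist-mono G (ℕ.n≤1+n 2) (dist-trans G (to-p us) (dist-sym G (to-p ut)))
    ... | inj₁ us | inj₂ vt = across us vt
    ... | inj₂ vs | inj₁ ut = dist-sym G (across ut vs)
    ... | inj₂ vs | inj₂ vt = dist-mono G (ℕ.n≤1+n 2) (dist-trans G (dist-sym G (from-q vs)) (from-q vt))

-- Let α(G) = 2, d(u,v) ≥ 3, let w ∈ N(u) be adjacent to every vertex but
-- v, and let a₁ ∈ N(u), b₁ ∉ N[u] ∪ {v} be non-adjacent.  Then G ∈ 𝓗 with
-- A = N[u], a₂ = u, z = v, B ∖ {b} = N(v) and hub w.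

module RecogniseH {n : ℕ} (G : Graph n) (α : IsIndependenceNumber G 2)
       {u v : Fin n} (far : ¬ DistLe G 2 u v)
       {w : Fin n} (uw : Adj G u w) (w-adj : ∀ t → t ≢ w → t ≢ v → Adj G w t)
       {a₁ b₁ : Fin n} (ua₁ : Adj G u a₁) (b₁∉N[u] : ¬ ClosedNbhd G u b₁) (b₁≢v : b₁ ≢ v)
       (a₁b₁ : adj G a₁ b₁ ≡ false) where

  far′ : ¬ DistLe G 2 v u
  far′ = far ∘′ dist-sym G

  data Region (t : Fin n) : Part → Set where
    in-Z : t ≡ v → Region t inZ
    in-A : ClosedNbhd G u t → Region t inA
    in-B : t ≢ v → ¬ ClosedNbhd G u t → Region t inB

  region : ∀ t → Σ Part (Region t)
  region t with t Fin.≟ v | closedNbhd? G u t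
  ... | yes t≡v | _      = inZ , in-Z t≡v
  ... | no _    | yes ut = inA , in-A ut
  ... | no t≢v  | no ¬ut = inB , in-B t≢v ¬ut

  region-unique : ∀ {t P Q} → Region t P → Region t Q → P ≡ Q
  region-unique (in-Z _)     (in-Z _)     = refl
  region-unique (in-Z refl)  (in-A vt)    = ⊥-elim (far-disjoint G far vt (inj₁ refl))
  region-unique (in-Z t≡v)   (in-B t≢v _) = ⊥-elim (t≢v t≡v)
  region-unique (in-A vt)    (in-Z refl)  = ⊥-elim (far-disjoint G far vt (inj₁ refl))
  region-unique (in-A _)     (in-A _)     = refl
  region-unique (in-A ut)    (in-B _ ¬ut) = ⊥-elim (¬ut ut)
  region-unique (in-B t≢v _) (in-Z t≡v)   = ⊥-elim (t≢v t≡v)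
  region-unique (in-B _ ¬ut) (in-A ut)    = ⊥-elim (¬ut ut)
  region-unique (in-B _ _)   (in-B _ _)   = refl

  part : Fin n → Part
  part t = proj₁ (region t)

  region-of : ∀ {t P} → part t ≡ P → Region t P
  region-of {t} e = subst (Region t) e (proj₂ (region t))

  part-of : ∀ {t P} → Region t P → part t ≡ P
  part-of {t} r = region-unique (proj₂ (region t)) r

  B⇒adj-v : ∀ {t} → Region t inB → Adj G v t
  B⇒adj-v {t} (in-B t≢v ¬ut) with far-cover G α far t
  ... | inj₁ ut          = ⊥-elim (¬ut ut)
  ... | inj₂ (inj₁ t≡v) = ⊥-elim (t≢v t≡v)
  ... | inj₂ (inj₂ vt)  = vt

  w≢ : ∀ {t} → ¬ ClosedNbhd G u t → t ≢ w
  w≢ ¬ut refl = ¬ut (inj₂ uw)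

  A-clique : ∀ t s → part t ≡ inA → part s ≡ inA → t ≢ s → Adj G t s
  A-clique t s pt ps with region-of pt | region-of ps
  ... | in-A ut | in-A us = far-clique G α far ut us

  B-clique : ∀ t s → part t ≡ inB → part s ≡ inB → t ≢ s → Adj G t s
  B-clique t s pt ps = far-clique G α far′ (inj₂ (B⇒adj-v (region-of pt))) (inj₂ (B⇒adj-v (region-of ps)))

  w-B : ∀ t → part t ≡ inB → Adj G w t
  w-B t pt with region-of pt
  ... | in-B t≢v ¬ut = w-adj t (w≢ ¬ut) t≢v

  z-nonadj : ∀ t → part t ≢ inB → adj G v t ≡ false
  z-nonadj t = nonadj (proj₂ (region t))
    where
    nonadj : ∀ {P} → Region t P → P ≢ inB → adj G v t ≡ false
    nonadj (in-Z refl) _   = irrefl G v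
    nonadj (in-A ut)   _   = ¬-not λ vt → far-disjoint G far ut (inj₂ vt)
    nonadj (in-B _ _)  ≢B = ⊥-elim (≢B refl)

  a₂-nonadj : ∀ t → part t ≢ inA → adj G u t ≡ false
  a₂-nonadj t = nonadj (proj₂ (region t))
    where
    nonadj : ∀ {P} → Region t P → P ≢ inA → adj G u t ≡ false
    nonadj (in-Z refl)  _   = far⇒nonadjacent G (s≤s z≤n) far
    nonadj (in-A _)     ≢A = ⊥-elim (≢A refl)
    nonadj (in-B _ ¬ut) _   = ¬-not (¬ut ∘′ inj₂)

  witness : InH G
  witness = record
    { part = part ; a₁ = a₁ ; a₂ = u ; w = w ; b₁ = b₁ ; z = v
    ; a₁≢a₂ = adj⇒≢ G ua₁ ∘′ sym
    ; a₁≢w = λ { refl → not-¬ (w-adj b₁ (w≢ b₁∉N[u]) b₁≢v) a₁b₁ }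
    ; a₂≢w = adj⇒≢ G uw
    ; a₁∈A = part-of (in-A (inj₂ ua₁))
    ; a₂∈A = part-of (in-A (inj₁ refl))
    ; w∈A = part-of (in-A (inj₂ uw))
    ; b₁∈B = part-of (in-B b₁≢v b₁∉N[u])
    ; z∈Z = part-of (in-Z refl)
    ; Z-only-z = λ t pt → case-Z (region-of pt)
    ; A-clique = A-clique
    ; B-clique = B-clique
    ; w-B = w-B
    ; z-adj = λ t pt → B⇒adj-v (region-of pt)
    ; z-nonadj = z-nonadj
    ; a₂-nonadj = a₂-nonadj
    ; a₁b₁ = a₁b₁
    }
    where
    case-Z : ∀ {t} → Region t inZ → t ≡ v
    case-Z (in-Z t≡v) = t≡v

-- Any two non-adjacent
-- vertices x, y outside {u, v} are split between N(u) and N(v), since both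
-- closed neighbourhoods are cliques; so G ∈ 𝓗.
module _ {n : ℕ} (G : Graph n) (α : IsIndependenceNumber G 2) {u v : Fin n} (far : ¬ DistLe G 2 u v)
         {w : Fin n} (uw : Adj G u w)
         (unique : ∀ a b → a ≢ w → b ≢ w → adj G w a ≡ false → adj G w b ≡ false → a ≡ b) where

  private
    w≢v : w ≢ v
    w≢v refl = not-¬ uw (far⇒nonadjacent G (s≤s z≤n) far)

    w-adj : ∀ t → t ≢ w → t ≢ v → Adj G w t
    w-adj t t≢w t≢v = ¬-not λ wt → t≢v (unique t v t≢w (w≢v ∘′ sym) wt
                        (¬-not λ wv → far-disjoint G far (inj₂ uw) (inj₂ (trans (adj-sym G v w) wv))))

    outside-N[u] : ∀ {t} → t ≢ u → adj G u t ≡ false → ¬ ClosedNbhd G u t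
    outside-N[u] t≢u ut (inj₁ t≡u) = t≢u t≡u
    outside-N[u] t≢u ut (inj₂ ut′) = not-¬ ut′ ut

    inside-N[v] : ∀ {t} → t ≢ u → t ≢ v → adj G u t ≡ false → ClosedNbhd G v t
    inside-N[v] {t} t≢u t≢v ut with far-cover G α far t
    ... | inj₁ ut′ = ⊥-elim (outside-N[u] t≢u ut ut′)
    ... | inj₂ vt  = vt

  far-hub⇒H : ∀ {x y} → x ≢ y → adj G x y ≡ false → x ≢ u → x ≢ v → y ≢ u → y ≢ v → InH G
  far-hub⇒H {x} {y} x≢y xy x≢u x≢v y≢u y≢v with adj G u x in ux | adj G u y in uy
  ... | true  | true  = ⊥-elim (not-¬ (far-clique G α far (inj₂ ux) (inj₂ uy) x≢y) xy)
  ... | true  | false = RecogniseH.witness G α far uw w-adj ux (outside-N[u] y≢u uy) y≢v xy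
  ... | false | true  = RecogniseH.witness G α far uw w-adj uy (outside-N[u] x≢u ux) x≢v
                          (trans (adj-sym G y x) xy)
  ... | false | false = ⊥-elim (not-¬ (far-clique G α (far ∘′ dist-sym G)
                          (inside-N[v] x≢u x≢v ux) (inside-N[v] y≢u y≢v uy) x≢y) xy)

Δ≡degree : ∀ {n} (G : Graph n) {w} → (∀ t → degree G t ≤ degree G w) → maxDegree G ≡ degree G w
Δ≡degree G {w} h = ℕ.≤-antisym (Δ≤ G (degree G w) h) (degree≤Δ G w)

module HFacts {n : ℕ} (G : Graph n) (W : InH G) where
  open HWitness W

  separated : ∀ {x y P Q} → part x ≡ P → part y ≡ Q → P ≢ Q → x ≢ y
  separated px qy P≢Q refl = P≢Q (trans (sym px) qy)

  other-part : ∀ {t P Q} → part t ≡ P → P ≢ Q → part t ≢ Q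
  other-part pt P≢Q e = P≢Q (trans (sym pt) e)

  w-adj : ∀ t → t ≢ w → t ≢ z → Adj G w t
  w-adj t t≢w t≢z with part t in pt
  ... | inA = A-clique w t w∈A pt (t≢w ∘′ sym)
  ... | inB = w-B t pt
  ... | inZ = ⊥-elim (t≢z (Z-only-z t pt))

  -- Every vertex has a non-neighbour: z for A-vertices, a₂ for the others.
  nonneighbour : ∀ t → ∃ λ y → y ≢ t × adj G t y ≡ false
  nonneighbour t with part t in pt
  ... | inA = z , separated z∈Z pt (λ ()) , trans (adj-sym G t z) (z-nonadj t (other-part pt λ ()))
  ... | inB = a₂ , separated a₂∈A pt (λ ()) , trans (adj-sym G t a₂) (a₂-nonadj t (other-part pt λ ()))
  ... | inZ = a₂ , separated a₂∈A pt (λ ()) , trans (adj-sym G t a₂) (a₂-nonadj t (other-part pt λ ()))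

  Δ+2≡n : maxDegree G + 2 ≡ n
  Δ+2≡n = trans (cong (_+ 2) (Δ≡degree G degree≤w)) (ℕ.≤-antisym (lower-bound w) upper-bound)
    where
    lower-bound : ∀ t → degree G t + 2 ≤ n
    lower-bound t with nonneighbour t
    ... | y , y≢t , ty = subst (_≤ n) (ℕ.+-comm 2 (degree G t)) (degree-nonneighbour G t y y≢t ty)
    upper-bound : n ≤ degree G w + 2
    upper-bound = subst (n ≤_) (ℕ.+-comm 2 (degree G w))
      (degree-all-but-one G w z (separated z∈Z w∈A (λ ())) (λ t t≢w t≢z → w-adj t t≢w t≢z))
    degree≤w : ∀ t → degree G t ≤ degree G w
    degree≤w t = ℕ.+-cancelʳ-≤ 2 _ _ (ℕ.≤-trans (lower-bound t) upper-bound)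

  z~w : DistLe G 2 z w
  z~w = dist-trans G (dist-adj G (z-adj b₁ b₁∈B)) (dist-adj G (trans (adj-sym G b₁ w) (w-B b₁ b₁∈B)))

  near-w : ∀ {t} → t ≢ z → DistLe G 1 t w
  near-w {t} t≢z with t Fin.≟ w
  ... | yes refl = dist-refl G
  ... | no t≢w   = dist-sym G (dist-adj G (w-adj t t≢w t≢z))

  diameter≤3 : ∀ s t → DistLe G 3 s t
  diameter≤3 s t with s Fin.≟ z | t Fin.≟ z
  ... | yes refl | yes refl = dist-refl G
  ... | yes refl | no t≢z   = dist-trans G z~w (dist-sym G (near-w t≢z))
  ... | no s≢z   | yes refl = dist-trans G (near-w s≢z) (dist-sym G z~w)
  ... | no s≢z   | no t≢z   = dist-mono G (ℕ.n≤1+n 2) (dist-trans G (near-w s≢z) (dist-sym G (near-w t≢z)))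

  -- z and a₂ are at distance ≥ 3: N(z) lies in B while N(a₂) lies in A.
  z-far-a₂ : ¬ DistLe G 2 z a₂
  z-far-a₂ = no-common-neighbour⇒far G (separated z∈Z a₂∈A (λ ()))
    (z-nonadj a₂ (other-part a₂∈A λ ()))
    λ x zx → trans (adj-sym G x a₂) (a₂-nonadj x (other-part (in-B x zx) λ ()))
    where
    in-B : ∀ x → Adj G z x → part x ≡ inB
    in-B x zx with part x in px
    ... | inB = refl
    ... | inA = ⊥-elim (not-¬ zx (z-nonadj x (other-part px λ ())))
    ... | inZ = ⊥-elim (not-¬ zx (z-nonadj x (other-part px λ ())))

module Directions {n : ℕ} (G : Graph n) (α : IsIndependenceNumber G 2)
                  {k : ℕ} (χ : IsPackingChromaticNumber G k) where

  c : Fin n → Fin k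
  c = proj₁ (proj₁ χ)

  packing : IsPackingColouring G k c
  packing = proj₂ (proj₁ χ)

  open PackingColouring G c packing
  open PackingLowerBound G α c packing

  Δ : ℕ
  Δ = maxDegree G

  minimal : ∀ {k′} → HasPackingColouring G k′ → k ≤ k′
  minimal = proj₂ χ _

  -- A vertex of maximum degree (G has vertices since α(G) = 2).
  hub : Fin n
  hub = proj₁ (Δ-attained G (proj₁ (nonadjacent-pair G α)))

  degree-hub : degree G hub ≡ Δ
  degree-hub = proj₂ (Δ-attained G (proj₁ (nonadjacent-pair G α)))

  -- If Δ = n - 1, the hub is adjacent to all vertices, so the diameter is
  -- at most 2 and n ≤ χ_ρ + 1; a non-adjacent pair gives χ_ρ ≤ n - 1.
  universal⇒k≡Δ : Δ + 1 ≡ n → k ≡ Δ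
  universal⇒k≡Δ Δ+1≡n = ℕ.≤-antisym upper lower
    where
    upper : k ≤ Δ
    upper with nonadjacent-pair G α
    ... | _ , _ , p≢q , pq = minimal (nonadjacent-pair⇒colouring G (trans (ℕ.+-comm 1 Δ) Δ+1≡n) p≢q pq)
    hub-adj : ∀ t → t ≢ hub → Adj G hub t
    hub-adj t t≢hub = ¬-not λ ht → ℕ.<-irrefl refl (subst (suc (suc (degree G hub)) ≤_)
      (trans (sym Δ+1≡n) (trans (ℕ.+-comm Δ 1) (cong suc (sym degree-hub))))
      (degree-nonneighbour G hub t t≢hub ht))
    near : ∀ t → DistLe G 1 t hub
    near t with t Fin.≟ hub
    ... | yes refl = dist-refl G
    ... | no t≢hub = dist-sym G (dist-adj G (hub-adj t t≢hub))
    lower : Δ ≤ k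
    lower = ℕ.+-cancelʳ-≤ 1 Δ k (subst (_≤ k + 1) (sym Δ+1≡n)
      (diameter-bound 1 λ s t → dist-trans G (near s) (dist-sym G (near t))))

  -- If G ∈ 𝓗 then Δ = n - 2 and the diameter is at most 3, so n ≤ χ_ρ + 2;
  -- the far pairs {a₁, b₁} and {z, a₂} give χ_ρ ≤ n - 2.
  H⇒k≡Δ : InH G → k ≡ Δ
  H⇒k≡Δ W = ℕ.≤-antisym upper lower
    where
    open HWitness W
    open HFacts G W
    upper : k ≤ Δ
    upper = minimal (two-pairs⇒colouring G (trans (ℕ.+-comm 2 Δ) Δ+2≡n)
      (separated a₁∈A b₁∈B λ ()) (separated a₁∈A z∈Z λ ()) a₁≢a₂
      (separated b₁∈B z∈Z λ ()) (separated b₁∈B a₂∈A λ ()) (separated z∈Z a₂∈A λ ())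
      a₁b₁ z-far-a₂)
    lower : Δ ≤ k
    lower = ℕ.+-cancelʳ-≤ 2 Δ k (subst (_≤ k + 2) (sym Δ+2≡n) (diameter-bound 2 diameter≤3))

  -- Since n ≥ χ_ρ + 2, two colours are
  -- repeated, one of them not colour 0: its class is a pair u, v with
  -- d(u,v) ≥ 3, and the other class is a non-adjacent pair x, y outside
  -- {u, v}.  An edge between N[u] and N[v] must exist (otherwise the hub's
  -- neighbourhood is a clique and χ_ρ > Δ); it forces diameter ≤ 3, hence
  -- Δ = n - 2, and the hub is then the vertex w of the 𝓗-decomposition.
  module _ (k≡Δ : k ≡ Δ) (Δ+1≢n : Δ + 1 ≢ n) where

    k+1<n : suc (k + 1) ≤ n
    k+1<n = subst (λ d → suc (d + 1) ≤ n) (sym k≡Δ) (ℕ.≤∧≢⇒< Δ+1≤n Δ+1≢n)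
      where
      Δ+1≤n : Δ + 1 ≤ n
      Δ+1≤n = subst (_≤ n) (trans (cong suc degree-hub) (ℕ.+-comm 1 Δ)) (degree<n G hub)

    from-cross-edge : ∀ {u v} (far : ¬ DistLe G 2 u v) {p q} → ClosedNbhd G u p → ClosedNbhd G v q →
      Adj G p q → ∀ {x y} → x ≢ y → adj G x y ≡ false → x ≢ u → x ≢ v → y ≢ u → y ≢ v → InH G
    from-cross-edge {u} {v} far up vq pq x≢y xy x≢u x≢v y≢u y≢v = hub-side (far-cover G α far hub)
      where
      degree≡k : degree G hub ≡ k
      degree≡k = trans degree-hub (sym k≡Δ)
      degree+2≡n : degree G hub + 2 ≡ n
      degree+2≡n = ℕ.≤-antisym (subst (λ d → d + 2 ≤ n) (sym degree≡k) (subst (_≤ n) (sym (ℕ.+-suc k 1)) k+1<n))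
        (subst (λ d → n ≤ d + 2) (sym degree≡k) (diameter-bound 2 (cross-edge⇒diameter≤3 G α far up vq pq)))
      unique : ∀ a b → a ≢ hub → b ≢ hub → adj G hub a ≡ false → adj G hub b ≡ false → a ≡ b
      unique = degree-n-2⇒unique-nonneighbour G hub degree+2≡n
      -- the hub is neither u nor v, which have two non-neighbours each
      not-far-end : ∀ {t t′ s} → t ≡ hub → ¬ DistLe G 2 t t′ → Adj G t′ s → ⊥
      not-far-end refl far′ t′s = ℕ.<-irrefl refl (subst (suc (suc (suc (degree G hub))) ≤_)
        (sym (trans (ℕ.+-comm 2 _) degree+2≡n)) (far⇒degree≤n-3 G far′ t′s))
      hub-side : ClosedNbhd G u hub ⊎ ClosedNbhd G v hub → InH G
      hub-side (inj₁ (inj₁ hub≡u)) = ⊥-elim (not-far-end (sym hub≡u) far (proj₂ (cross-edge-ends G α far up vq pq)))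
      hub-side (inj₁ (inj₂ u-hub)) = far-hub⇒H G α far u-hub unique x≢y xy x≢u x≢v y≢u y≢v
      hub-side (inj₂ (inj₁ hub≡v)) = ⊥-elim (not-far-end (sym hub≡v) (far ∘′ dist-sym G)
                                        (proj₁ (cross-edge-ends G α far up vq pq)))
      hub-side (inj₂ (inj₂ v-hub)) = far-hub⇒H G α (far ∘′ dist-sym G) v-hub unique x≢y xy x≢v x≢u y≢v y≢u

    -- Without a cross edge the hub's neighbourhood is a clique, so χ_ρ > Δ.
    from-far-pair : ∀ {u v} → ¬ DistLe G 2 u v → ∀ {x y} → x ≢ y → adj G x y ≡ false →
                    x ≢ u → x ≢ v → y ≢ u → y ≢ v → InH G
    from-far-pair far x≢y xy x≢u x≢v y≢u y≢v with cross-edge? G α far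
    ... | yes (p , q , up , vq , pq) = from-cross-edge far up vq pq x≢y xy x≢u x≢v y≢u y≢v
    ... | no none = ⊥-elim (ℕ.<-irrefl refl (subst (_≤ k) (cong suc (trans degree-hub (sym k≡Δ)))
                      (clique-neighbourhood⇒degree<k hub (no-cross-edge⇒clique-neighbourhoods G α far none hub))))

    colours≢ : ∀ {x t} → toℕ (c x) ≢ toℕ (c t) → x ≢ t
    colours≢ ne refl = ne refl

    second-pair : ∀ {u v} → c u ≡ c v → ¬ DistLe G 2 u v → InH G
    second-pair {u} {v} cu≡cv far with repeated-avoiding (toℕ (c u)) k+1<n
    ... | x , y , x≢y , cx≡cy , cx≢cu =
      from-far-pair far x≢y (same-colour⇒nonadjacent x≢y cx≡cy)
        (colours≢ cx≢cu) (colours≢ (λ e → cx≢cu (trans e (cong toℕ (sym cu≡cv)))))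
        (colours≢ (λ e → cx≢cu (trans (cong toℕ cx≡cy) e)))
        (colours≢ (λ e → cx≢cu (trans (cong toℕ cx≡cy) (trans e (cong toℕ (sym cu≡cv))))))

    k≡Δ⇒H : InH G
    k≡Δ⇒H with repeated-avoiding 0 k+1<n
    ... | u , v , u≢v , cu≡cv , cu≢0 =
      second-pair cu≡cv λ d → packing u v u≢v cu≡cv (dist-mono G (s≤s (ℕ.n≢0⇒n>0 cu≢0)) d)

theorem4p2 : (n : ℕ) (G : Graph n) (a k : ℕ) →
    IsIndependenceNumber G a → a ≡ 2 →
    IsPackingChromaticNumber G k →
    (k + a ≡ maxDegree G + 2) ⇔ (maxDegree G + 1 ≡ n ⊎ InH G)
theorem4p2 n G a k α refl χ = mk⇔ characterise realise
  where
  open Directions G α χ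
  characterise : k + 2 ≡ Δ + 2 → Δ + 1 ≡ n ⊎ InH G
  characterise k+2≡Δ+2 with Δ + 1 ℕ.≟ n
  ... | yes Δ+1≡n = inj₁ Δ+1≡n
  ... | no  Δ+1≢n = inj₂ (k≡Δ⇒H (ℕ.+-cancelʳ-≡ 2 k Δ k+2≡Δ+2) Δ+1≢n)
  realise : Δ + 1 ≡ n ⊎ InH G → k + 2 ≡ Δ + 2
  realise (inj₁ Δ+1≡n) = cong (_+ 2) (universal⇒k≡Δ Δ+1≡n)
  realise (inj₂ W)     = cong (_+ 2) (H⇒k≡Δ W)
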